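{- Let $\diamond$ be one of the unary operations maximal ($\mathcal{F}\mapsto\mathcal{F}^\uparrow$) or minimal ($\mathcal{F}\mapsto\mathcal{F}^\downarrow$). Then there exist, for each positive integer $m$, a finite ground set $U_m$ with $|U_m|=O(m^2)$, a total order $<_m$ on $U_m$, and a family $\mathcal{F}_m$ of subsets of $U_m$ such that $Z_{<_m}(\mathcal{F}_m)=O(m^4)$ and $Z_{<_m}(\mathcal{F}_m^\diamond)=\Omega(2^{m}/\mathrm{poly}(m))$, i.e. $Z_{<_m}(\mathcal{F}_m^\diamond)\ge 2^m/p(m)$ for some polynomial $p$ and all sufficiently large $m$.
   Context: A family of sets is a set of subsets of a finite ground set $U$. Maximal: $\mathcal{F}^\uparrow=\{F\in\mathcal{F}\mid\forall F'\in\mathcal{F}: F\subseteq F'\Rightarrow F=F'\}$. Minimal: $\mathcal{F}^\downarrow=\{F\in\mathcal{F}\mid\forall F'\in\mathcal{F}: F'\subseteq F\Rightarrow F=F'\}$. A zero-suppressed binary decision diagram (ZDD) with respect to a total order $<$ on $U$ is a rooted DAG with two terminal nodes $\top,\bot$ and internal nodes $\mathtt{n}$, each with a label $\mathsf{lb}(\mathtt{n})\in U$ and children $\mathsf{lo}(\mathtt{n}),\mathsf{hi}(\mathtt{n})$, labels strictly increasing along arcs. A node represents: $\{\emptyset\}$ if $\top$, $\emptyset$ if $\bot$, and $\mathcal{F}_{\mathsf{lo}(\mathtt{n})}\cup\{\{\mathsf{lb}(\mathtt{n})\}\cup S\mid S\in\mathcal{F}_{\mathsf{hi}(\mathtt{n})}\}$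 otherwise; the ZDD represents the family of its root. The reduced ZDD (obtained by merging nodes with identical label and children and deleting nodes whose hi-child is $\bot$) is the unique smallest ZDD for the family and order; $Z_<(\mathcal{F})$ is its number of nodes. Asymptotics are as $m\to\infty$. -}

module Defs where

open import Data.Nat using (ℕ; suc; _+_)
open import Data.Fin using (Fin) renaming (_<_ to _<ᶠ_)
open import Data.Fin.Subset using (Subset; ⁅_⁆; _∪_; _⊆_) renaming (⊥ to ∅)
open import Data.Vec using (Vec; lookup)
open import Data.Product using (Σ; _×_)
open import Relation.Binary.PropositionalEquality using (_≡_)

Family : ℕ → Set₁
Family n = Subset n → Set

maximal : ∀ {n} → Family n → Family n
maximal F S = F S × (∀ S' → F S' → S ⊆ S' → S ≡ S')

minimal : ∀ {n} → Family n → Family n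
minimal F S = F S × (∀ S' → F S' → S' ⊆ S → S ≡ S')

data UnOp : Set where
  maxOp minOp : UnOp

apply : UnOp → ∀ {n} → Family n → Family n
apply maxOp = maximal
apply minOp = minimal

-- ZDDs over ground set Fin n ordered by the natural order of Fin n.
-- A ZDD with k internal nodes: internal nodes are indexed by Fin k,
-- the two terminal nodes are ⊤ and ⊥.

data Ref (k : ℕ) : Set where
  ⊤ᵣ : Ref k
  ⊥ᵣ : Ref k
  node : Fin k → Ref k

record Node (n k : ℕ) : Set where
  constructor mkNode
  field
    lb : Fin n
    lo : Ref k
    hi : Ref k
open Node public

record ZDD (n k : ℕ) : Set where
  field
    nodes : Vec (Node n k) k
    root  : Ref k
open ZDD public

LabelAbove : ∀ {n k} → Vec (Node n k) k → Fin n → Ref k → Set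
LabelAbove ns l ⊤ᵣ = Data.Unit.⊤ where import Data.Unit
LabelAbove ns l ⊥ᵣ = Data.Unit.⊤ where import Data.Unit
LabelAbove ns l (node j) = l <ᶠ lb (lookup ns j)

WellFormed : ∀ {n k} → ZDD n k → Set
WellFormed {n} {k} Z = ∀ (i : Fin k) →
  LabelAbove (nodes Z) (lb (lookup (nodes Z) i)) (lo (lookup (nodes Z) i)) ×
  LabelAbove (nodes Z) (lb (lookup (nodes Z) i)) (hi (lookup (nodes Z) i))

data Mem {n k : ℕ} (ns : Vec (Node n k) k) : Ref k → Subset n → Set where
  top : Mem ns ⊤ᵣ ∅
  viaLo : ∀ {i S} → Mem ns (lo (lookup ns i)) S → Mem ns (node i) S
  viaHi : ∀ {i S S'} → Mem ns (hi (lookup ns i)) S' →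
          S ≡ ⁅ lb (lookup ns i) ⁆ ∪ S' → Mem ns (node i) S

Represents : ∀ {n k} → ZDD n k → Family n → Set
Represents Z F = ∀ S → (Mem (nodes Z) (root Z) S → F S) × (F S → Mem (nodes Z) (root Z) S)

-- Number of nodes: k internal nodes plus the two terminals.
size : ∀ {n k} → ZDD n k → ℕ
size {k = k} _ = k + 2

-- Z_<(F) is the size of the smallest ZDD representing F.
-- "Z_<(F) ≤ b": some ZDD representing F has at most b nodes.
Z≤ : ∀ {n} → Family n → ℕ → Set
Z≤ {n} F b = Σ ℕ λ k → Σ (ZDD n k) λ Z → WellFormed Z × Represents Z F × (size Z Data.Nat.≤ b)
  where import Data.Nat

-- "num / den ≤ Z_<(F)" (rational lower bound, cleared of denominators):
-- every ZDD representing F has s nodes with num ≤ s * den.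
Z≥frac : ∀ {n} → Family n → ℕ → ℕ → Set
Z≥frac {n} F num den = ∀ k (Z : ZDD n k) → WellFormed Z → Represents Z F →
  num Data.Nat.≤ size Z Data.Nat.* den
  where import Data.Nat

-- Sets over 3m points are read as w ++ a ++ b with three blocks of length m; let p be false for
-- maximal and true for minimal sets.  The family contains w ++ a ++ b when ∣ a ∣ + ∣ b ∣ = m and either
-- w = pᵐ, or w differs from pᵐ at exactly one position i with i ∈ a and i ∈ b.  An automaton that reads the
-- bits in order and remembers only the deviation and how many ones are still due has (m + 1)² states per
-- level, and such an automaton unfolds into a ZDD with 3m(m + 1)² + 2 nodes.
--
-- Every pᵐ ++ A ++ ∁ A is an extremal member: a comparable member has the same a and b
-- by counting, and A ∩ ∁ A = ∅ rules out a deviation.  If i ∈ X but i ∉ Y, then pᵐ ++ X ++ ∁ Y is not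
-- extremal, as changing bit i of w gives a member above it (p false) or below it (p true).  So the pairs
-- (pᵐ ++ X, ∁ Y) form a fooling set: in any ZDD for the extremal sets the prefixes pᵐ ++ X lead to 2ᵐ
-- distinct nodes.
module Submission where

open import Defs
open import Data.Nat using (ℕ; _*_; _^_; _≤_)
open import Data.Product using (Σ; _×_; proj₁; proj₂)

open import Data.Bool using (Bool; true; false; not; if_then_else_) renaming (_≟_ to _≟ᵇ_)
open import Data.Bool.Properties using (not-¬)
open import Data.Empty using (⊥-elim) renaming (⊥ to Empty)
open import Data.Fin as Fin using (Fin; zero; suc; toℕ; fromℕ<; combine; remQuot; finToFun; funToFin)
open import Data.Fin.Properties
  using (toℕ<n; toℕ-fromℕ; toℕ-inject₁; fromℕ<-toℕ; toℕ-fromℕ<; toℕ-injective; remQuot-combine;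
         injective⇒≤; funToFin-finToFin)
open import Data.Fin.Subset using (Subset; ⁅_⁆; _∪_; ∣_∣; _∈_; _∉_; _⊆_; ∁) renaming (⊥ to ∅)
open import Data.Fin.Subset.Properties
  using (∪-identityˡ; drop-∷-⊆; p⊆q⇒∣p∣≤∣q∣; ∣∁p∣≡n∸∣p∣; ∣p∣≤n; ⊆-refl; ⊆-antisym; ⊥⊆; ⊆⊤;
         x∈p⇒x∉∁p; x∉p⇒x∈∁p; _∈?_)
open import Data.List using (List; []; _∷_; length; replicate; _++_)
open import Data.List.Properties using (++-identityʳ)
import Data.List.Properties as Listₚ
open import Data.Maybe using (Maybe; just; nothing; maybe′; _>>=_)
open import Data.Nat using (zero; suc; _+_; _∸_; _<_; z≤n; s≤s; s≤s⁻¹; _<?_; _≟_)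
open import Data.Nat.Properties
open import Data.Nat.Solver using (module +-*-Solver)
open import Data.Product using (_,_; uncurry)
open import Data.Sum using (_⊎_; inj₁; inj₂)
open import Data.Unit using (⊤; tt)
open import Data.Vec as Vec using (Vec; []; _∷_; toList; lookup; tabulate; here; there)
open import Data.Vec.Properties using (lookup∘tabulate; toList-replicate; toList-injective; cast-is-id)
import Data.Vec.Properties as Vecₚ
open import Function using (_∘_; id)
open import Relation.Nullary using (¬_; yes; no; contradiction)
open import Relation.Binary.PropositionalEquality

open +-*-Solver using (solve; _:+_; _:*_; _:^_; _:=_; con)

bitAt : List Bool → ℕ → Bool
bitAt []      _       = false
bitAt (b ∷ L) zero    = b
bitAt (b ∷ L) (suc y) = bitAt L y

prefix-length : ∀ {n} (S : Subset n) j L → toList S ≡ replicate j false ++ L → j + length L ≡ n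
prefix-length S j L e = begin
  j + length L                      ≡⟨ cong (_+ length L) (Listₚ.length-replicate j) ⟨
  length (replicate j false) + length L ≡⟨ Listₚ.length-++ (replicate j false) ⟨
  length (replicate j false ++ L)       ≡⟨ cong length e ⟨
  length (toList S)                 ≡⟨ Vecₚ.length-toList S ⟩
  _                                 ∎
  where open ≡-Reasoning

zeros⇒∅ : ∀ {n j} {S : Subset n} → toList S ≡ replicate j false → S ≡ ∅
zeros⇒∅ {S = []}              _ = refl
zeros⇒∅ {j = suc j} {b ∷ S} e = cong₂ _∷_ (Listₚ.∷-injectiveˡ e) (zeros⇒∅ (Listₚ.∷-injectiveʳ e))

toList-inj : ∀ {n} {u v : Vec Bool n} → toList u ≡ toList v → u ≡ v
toList-inj {u = u} {v} e = trans (sym (cast-is-id refl u)) (toList-injective refl u v e)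

lookup≡bitAt : ∀ {n} (v : Vec Bool n) i → lookup v i ≡ bitAt (toList v) (toℕ i)
lookup≡bitAt (b ∷ v) zero    = refl
lookup≡bitAt (b ∷ v) (suc i) = lookup≡bitAt v i

replicate-suc-++ : ∀ j (b : Bool) L → replicate (suc j) b ++ L ≡ replicate j b ++ (b ∷ L)
replicate-suc-++ zero    b L = refl
replicate-suc-++ (suc j) b L = cong (b ∷_) (replicate-suc-++ j b L)

bitAt-replicate-++-< : ∀ j L {y} → y < j → bitAt (replicate j false ++ L) y ≡ false
bitAt-replicate-++-< (suc j) L {zero}  _         = refl
bitAt-replicate-++-< (suc j) L {suc y} (s≤s y<j) = bitAt-replicate-++-< j L y<j

bitAt-∅ : ∀ n y → bitAt (toList (∅ {n})) y ≡ false
bitAt-∅ zero    y       = refl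
bitAt-∅ (suc n) zero    = refl
bitAt-∅ (suc n) (suc y) = bitAt-∅ n y

bitAt-⁅l⁆∪ : ∀ {n} (l : Fin n) S → bitAt (toList (⁅ l ⁆ ∪ S)) (toℕ l) ≡ true
bitAt-⁅l⁆∪ zero    (b ∷ S) = refl
bitAt-⁅l⁆∪ (suc l) (b ∷ S) = bitAt-⁅l⁆∪ l S

bitAt-⁅l⁆∪-≢ : ∀ {n} (l : Fin n) S {y} → y ≢ toℕ l → bitAt (toList (⁅ l ⁆ ∪ S)) y ≡ bitAt (toList S) y
bitAt-⁅l⁆∪-≢ zero    (b ∷ S) {zero}  y≢l = ⊥-elim (y≢l refl)
bitAt-⁅l⁆∪-≢ zero    (b ∷ S) {suc y} y≢l = cong (λ T → bitAt (toList T) y) (∪-identityˡ S)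
bitAt-⁅l⁆∪-≢ (suc l) (b ∷ S) {zero}  y≢l = refl
bitAt-⁅l⁆∪-≢ (suc l) (b ∷ S) {suc y} y≢l = bitAt-⁅l⁆∪-≢ l S (y≢l ∘ cong suc)

toList-⁅l⁆∪ : ∀ {n} (l : Fin n) S L → toList S ≡ replicate (suc (toℕ l)) false ++ L →
  toList (⁅ l ⁆ ∪ S) ≡ replicate (toℕ l) false ++ (true ∷ L)
toList-⁅l⁆∪ zero    (b ∷ S) L e = cong₂ _∷_ refl (trans (cong toList (∪-identityˡ S)) (Listₚ.∷-injectiveʳ e))
toList-⁅l⁆∪ (suc l) (b ∷ S) L e = cong₂ _∷_ (Listₚ.∷-injectiveˡ e) (toList-⁅l⁆∪ l S L (Listₚ.∷-injectiveʳ e))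

splitAt-bit : ∀ {n} (S : Subset n) j L → toList S ≡ replicate j false ++ (true ∷ L) →
  Σ (Fin n) λ l → toℕ l ≡ j × Σ (Subset n) λ S' →
    toList S' ≡ replicate (suc j) false ++ L × S ≡ ⁅ l ⁆ ∪ S'
splitAt-bit (b ∷ S) zero L e rewrite Listₚ.∷-injectiveˡ e =
  zero , refl , false ∷ S , cong (false ∷_) (Listₚ.∷-injectiveʳ e) , cong (true ∷_) (sym (∪-identityˡ S))
splitAt-bit (b ∷ S) (suc j) L e with splitAt-bit S j L (Listₚ.∷-injectiveʳ e)
... | l , l≡j , S' , eS' , S≡ rewrite Listₚ.∷-injectiveˡ e =
  suc l , cong suc l≡j , false ∷ S' , cong (false ∷_) eS' , cong (false ∷_) S≡

⁅l⁆∪-injective : ∀ {n} (l : Fin n) {S T : Subset n} →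
  bitAt (toList S) (toℕ l) ≡ false → bitAt (toList T) (toℕ l) ≡ false → ⁅ l ⁆ ∪ S ≡ ⁅ l ⁆ ∪ T → S ≡ T
⁅l⁆∪-injective zero {false ∷ S} {false ∷ T} refl refl e =
  cong (false ∷_) (trans (sym (∪-identityˡ S)) (trans (Vecₚ.∷-injectiveʳ e) (∪-identityˡ T)))
⁅l⁆∪-injective (suc l) {b ∷ S} {c ∷ T} lS lT e =
  cong₂ _∷_ (Vecₚ.∷-injectiveˡ e) (⁅l⁆∪-injective l lS lT (Vecₚ.∷-injectiveʳ e))

-- Layered automata and their ZDDs

record LayeredAutomaton (n s : ℕ) : Set₁ where
  field
    State         : Set
    encode        : State → Fin s
    decode        : Fin s → State
    decode∘encode : ∀ q → decode (encode q) ≡ q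
    step          : ℕ → State → Bool → Maybe State
    accepting     : State → Bool
    initial       : State

  run : ℕ → State → List Bool → Maybe State
  run j q []      = just q
  run j q (b ∷ L) = step j q b >>= λ q′ → run (suc j) q′ L

  accepts : ℕ → State → List Bool → Bool
  accepts j q L = maybe′ accepting false (run j q L)

  language : Family n
  language S = accepts 0 initial (toList S) ≡ true

  accepts-∷⁻ : ∀ {j q b L} → accepts j q (b ∷ L) ≡ true →
    Σ State λ q′ → step j q b ≡ just q′ × accepts (suc j) q′ L ≡ true
  accepts-∷⁻ {j} {q} {b} acc with step j q b
  ... | just q′ = q′ , refl , acc

  accepts⁻ : ∀ j q L → accepts j q L ≡ true → Σ State λ q′ → run j q L ≡ just q′ × accepting q′ ≡ true
  accepts⁻ j q L acc with run j q L
  ... | just q′ = q′ , refl , acc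

  accepts⁺ : ∀ j q L {q′} → run j q L ≡ just q′ → accepting q′ ≡ true → accepts j q L ≡ true
  accepts⁺ j q L e acc rewrite e = acc

  run-∷⁻ : ∀ {j q b} L {q″} → run j q (b ∷ L) ≡ just q″ →
    Σ State λ q′ → step j q b ≡ just q′ × run (suc j) q′ L ≡ just q″
  run-∷⁻ {j} {q} {b} L e with step j q b
  ... | just q′ = q′ , refl , e

  run-∷⁺ : ∀ {j q b} L {q′ q″} → step j q b ≡ just q′ → run (suc j) q′ L ≡ just q″ → run j q (b ∷ L) ≡ just q″
  run-∷⁺ L s e rewrite s = e

  run-++⁻ : ∀ j q u v {q″} → run j q (u ++ v) ≡ just q″ →
    Σ State λ q′ → run j q u ≡ just q′ × run (j + length u) q′ v ≡ just q″
  run-++⁻ j q []      v {q″} e = q , refl , subst (λ i → run i q v ≡ just q″) (sym (+-identityʳ j)) e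
  run-++⁻ j q (b ∷ u) v {q″} e with step j q b
  ... | just q₁ with run-++⁻ (suc j) q₁ u v e
  ...   | q′ , e₁ , e₂ = q′ , e₁ , subst (λ i → run i q′ v ≡ just q″) (sym (+-suc j (length u))) e₂

  run-++⁺ : ∀ j q u v {q′ q″} → run j q u ≡ just q′ → run (j + length u) q′ v ≡ just q″ →
    run j q (u ++ v) ≡ just q″
  run-++⁺ j q []      v {q′} {q″} refl e₂ = subst (λ i → run i q v ≡ just q″) (+-identityʳ j) e₂
  run-++⁺ j q (b ∷ u) v {q′} {q″} e₁ e₂ with step j q b
  ... | just q₁ = run-++⁺ (suc j) q₁ u v e₁ (subst (λ i → run i q′ v ≡ just q″) (+-suc j (length u)) e₂)

-- Level j, state q becomes node (j, encode q); the sets it represents avoid 0, …, j - 1.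
module LayeredZDD {n s} (A : LayeredAutomaton n s) where
  open LayeredAutomaton A

  k : ℕ
  k = n * s

  ref : ℕ → State → Ref k
  ref j q with j <? n
  ... | yes j<n = node (combine (fromℕ< j<n) (encode q))
  ... | no _    = if accepting q then ⊤ᵣ else ⊥ᵣ

  child : ℕ → Maybe State → Ref k
  child j = maybe′ (ref j) ⊥ᵣ

  nodeAt : Fin n → State → Node n k
  nodeAt l q = mkNode l (child (suc (toℕ l)) (step (toℕ l) q false))
                        (child (suc (toℕ l)) (step (toℕ l) q true))

  nodeAt′ : Fin n × Fin s → Node n k
  nodeAt′ (l , c) = nodeAt l (decode c)

  ns : Vec (Node n k) k
  ns = tabulate (nodeAt′ ∘ remQuot s)

  zdd : ZDD n k
  zdd = record { nodes = ns ; root = ref 0 initial }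

  lookup-ns : ∀ i → lookup ns i ≡ nodeAt′ (remQuot s i)
  lookup-ns = lookup∘tabulate (nodeAt′ ∘ remQuot s)

  lookup-combine : ∀ l q → lookup ns (combine l (encode q)) ≡ nodeAt l q
  lookup-combine l q = begin
    lookup ns (combine l (encode q))         ≡⟨ lookup-ns _ ⟩
    nodeAt′ (remQuot s (combine l (encode q))) ≡⟨ cong nodeAt′ (remQuot-combine {n} l (encode q)) ⟩
    nodeAt l (decode (encode q))             ≡⟨ cong (nodeAt l) (decode∘encode q) ⟩
    nodeAt l q                               ∎
    where open ≡-Reasoning

  AcceptedFrom : ℕ → State → Subset n → Set
  AcceptedFrom j q S = Σ (List Bool) λ L → toList S ≡ replicate j false ++ L × accepts j q L ≡ true

  NodeMeaning : Fin n × Fin s → Subset n → Set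
  NodeMeaning (l , c) = AcceptedFrom (toℕ l) (decode c)

  Meaning : Ref k → Subset n → Set
  Meaning ⊤ᵣ       S = S ≡ ∅
  Meaning ⊥ᵣ       S = Empty
  Meaning (node i) S = NodeMeaning (remQuot {n} s i) S

  meaning-node : ∀ l q {S} → Meaning (node (combine l (encode q))) S → AcceptedFrom (toℕ l) q S
  meaning-node l q {S} m = subst (λ q′ → AcceptedFrom (toℕ l) q′ S) (decode∘encode q)
    (subst (λ lc → NodeMeaning lc S) (remQuot-combine {n} l (encode q)) m)

  meaning-ref : ∀ j q {S} → j ≤ n → Meaning (ref j q) S → AcceptedFrom j q S
  meaning-ref j q j≤n m with j <? n
  ... | yes j<n = subst (λ t → AcceptedFrom t q _) (toℕ-fromℕ< j<n) (meaning-node (fromℕ< j<n) q m)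
  ... | no j≮n with accepting q in acc
  ...   | true rewrite ≤-antisym j≤n (≮⇒≥ j≮n) | m =
    [] , trans (toList-replicate n false) (sym (++-identityʳ _)) , acc

  meaning-child : ∀ l q b {S} → Meaning (child (suc (toℕ l)) (step (toℕ l) q b)) S →
    Σ (List Bool) λ L → toList S ≡ replicate (suc (toℕ l)) false ++ L × accepts (toℕ l) q (b ∷ L) ≡ true
  meaning-child l q b m with step (toℕ l) q b
  ... | just q′ = meaning-ref (suc (toℕ l)) q′ (toℕ<n l) m

  sound : ∀ {r S} → Mem ns r S → Meaning r S
  sound top = refl
  sound {S = S} (viaLo {i} m) =
    lo-sound (remQuot s i) (subst (λ nd → Meaning (lo nd) S) (lookup-ns i) (sound m))
    where
    lo-sound : ∀ lc → Meaning (lo (nodeAt′ lc)) S → NodeMeaning lc S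
    lo-sound (l , c) m with meaning-child l (decode c) false m
    ... | L , eS , acc = false ∷ L , trans eS (replicate-suc-++ (toℕ l) false L) , acc
  sound {S = S} (viaHi {i} {S' = S′} m S≡) =
    hi-sound (remQuot s i) (subst (λ nd → Meaning (hi nd) S′) (lookup-ns i) (sound m))
                           (subst (λ nd → S ≡ ⁅ lb nd ⁆ ∪ S′) (lookup-ns i) S≡)
    where
    hi-sound : ∀ lc → Meaning (hi (nodeAt′ lc)) S′ → S ≡ ⁅ lb (nodeAt′ lc) ⁆ ∪ S′ → NodeMeaning lc S
    hi-sound (l , c) m refl with meaning-child l (decode c) true m
    ... | L , eS′ , acc = true ∷ L , toList-⁅l⁆∪ l S′ L eS′ , acc

  branch : Bool → Node n k → Ref k
  branch false = lo
  branch true  = hi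

  branch-ref : ∀ b j q (j<n : j < n) →
    branch b (lookup ns (combine (fromℕ< j<n) (encode q))) ≡ child (suc j) (step j q b)
  branch-ref false j q j<n rewrite lookup-combine (fromℕ< j<n) q | toℕ-fromℕ< j<n = refl
  branch-ref true  j q j<n rewrite lookup-combine (fromℕ< j<n) q | toℕ-fromℕ< j<n = refl

  complete : ∀ L j q {S} → toList S ≡ replicate j false ++ L → accepts j q L ≡ true → Mem ns (ref j q) S
  complete [] j q {S} eS acc with j <? n
  ... | yes j<n = ⊥-elim (<-irrefl (trans (sym (+-identityʳ j)) (prefix-length S j [] eS)) j<n)
  ... | no _ with accepting q
  ...   | true = subst (Mem ns ⊤ᵣ) (sym (zeros⇒∅ (trans eS (++-identityʳ _)))) top
  complete (b ∷ L) j q {S} eS acc with j <? n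
  ... | no j≮n = ⊥-elim (j≮n (subst (j <_) (prefix-length S j (b ∷ L) eS) (m<m+n j (s≤s z≤n))))
  ... | yes j<n = descend b eS (accepts-∷⁻ {L = L} acc)
    where
    descend : ∀ b → toList S ≡ replicate j false ++ (b ∷ L) →
      Σ State (λ q′ → step j q b ≡ just q′ × accepts (suc j) q′ L ≡ true) →
      Mem ns (node (combine (fromℕ< j<n) (encode q))) S
    descend false eS (q′ , e , acc′) =
      viaLo (subst (λ r → Mem ns r S) (sym (trans (branch-ref false j q j<n) (cong (child (suc j)) e)))
                   (complete L (suc j) q′ (trans eS (sym (replicate-suc-++ j false L))) acc′))
    descend true eS (q′ , e , acc′) with splitAt-bit S j L eS
    ... | l , l≡j , S′ , eS′ , S≡ =
      viaHi (subst (λ r → Mem ns r S′) (sym (trans (branch-ref true j q j<n) (cong (child (suc j)) e)))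
                   (complete L (suc j) q′ eS′ acc′))
            (trans S≡ (cong (λ x → ⁅ x ⁆ ∪ S′) (trans l≡fromℕ< (sym (cong lb (lookup-combine (fromℕ< j<n) q))))))
      where
      l≡fromℕ< : l ≡ fromℕ< j<n
      l≡fromℕ< = toℕ-injective (trans l≡j (sym (toℕ-fromℕ< j<n)))

  child-above : ∀ l mq → LabelAbove ns l (child (suc (toℕ l)) mq)
  child-above l nothing = tt
  child-above l (just q) with suc (toℕ l) <? n
  ... | yes j<n rewrite lookup-combine (fromℕ< j<n) q | toℕ-fromℕ< j<n = ≤-refl
  ... | no _ with accepting q
  ...   | true  = tt
  ...   | false = tt

  wellFormed : WellFormed zdd
  wellFormed i rewrite lookup-ns i = node-above (remQuot s i)
    where
    node-above : ∀ lc → LabelAbove ns (lb (nodeAt′ lc)) (lo (nodeAt′ lc)) ×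
                        LabelAbove ns (lb (nodeAt′ lc)) (hi (nodeAt′ lc))
    node-above (l , c) = child-above l (step (toℕ l) (decode c) false)
                       , child-above l (step (toℕ l) (decode c) true)

  represents : Represents zdd language
  represents S = (λ m → from-meaning (meaning-ref 0 initial z≤n (sound m)))
               , complete (toList S) 0 initial refl
    where
    from-meaning : AcceptedFrom 0 initial S → language S
    from-meaning (L , refl , acc) = acc

  language-Z≤ : Z≤ language (k + 2)
  language-Z≤ = k , zdd , wellFormed , represents , ≤-refl

-- Residuals and fooling sets

funToFin-cong : ∀ {m n} {f g : Fin m → Fin n} → f ≗ g → funToFin f ≡ funToFin g
funToFin-cong {zero}  f≗g = refl
funToFin-cong {suc m} f≗g = cong₂ combine (f≗g zero) (funToFin-cong (f≗g ∘ suc))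

finToFun-injective : ∀ {m n} {i j : Fin (n ^ m)} → finToFun {n} {m} i ≗ finToFun j → i ≡ j
finToFun-injective {m} {n} {i} {j} eq =
  trans (sym (funToFin-finToFin {m} {n} i)) (trans (funToFin-cong {m} {n} eq) (funToFin-finToFin {m} {n} j))

fin2→bool : Fin 2 → Bool
fin2→bool zero    = false
fin2→bool (suc _) = true

fin2→bool-injective : ∀ {a b} → fin2→bool a ≡ fin2→bool b → a ≡ b
fin2→bool-injective {zero}     {zero}     _ = refl
fin2→bool-injective {suc zero} {suc zero} _ = refl

bitVector : ∀ {m} → Fin (2 ^ m) → Vec Bool m
bitVector {m} i = tabulate (fin2→bool ∘ finToFun {2} {m} i)

bitVector-injective : ∀ {m} {i j : Fin (2 ^ m)} → bitVector i ≡ bitVector j → i ≡ j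
bitVector-injective {m} {i} {j} e = finToFun-injective {m} {2} λ x → fin2→bool-injective (begin
  fin2→bool (finToFun {2} {m} i x) ≡⟨ lookup∘tabulate (fin2→bool ∘ finToFun {2} {m} i) x ⟨
  lookup (bitVector i) x    ≡⟨ cong (λ v → lookup v x) e ⟩
  lookup (bitVector j) x    ≡⟨ lookup∘tabulate (fin2→bool ∘ finToFun {2} {m} j) x ⟩
  fin2→bool (finToFun {2} {m} j x) ∎)
  where open ≡-Reasoning

refToFin : ∀ {k} → Ref k → Fin (2 + k)
refToFin ⊤ᵣ       = zero
refToFin ⊥ᵣ       = suc zero
refToFin (node x) = suc (suc x)

refToFin-injective : ∀ {k} {r r′ : Ref k} → refToFin r ≡ refToFin r′ → r ≡ r′
refToFin-injective {r = ⊤ᵣ}     {⊤ᵣ}      _    = refl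
refToFin-injective {r = ⊥ᵣ}     {⊥ᵣ}      _    = refl
refToFin-injective {r = node x} {node .x} refl = refl

injection⇒2^m≤ : ∀ {m k} (f : Vec Bool m → Ref k) → (∀ {X Y} → f X ≡ f Y → X ≡ Y) → 2 ^ m ≤ k + 2
injection⇒2^m≤ {m} {k} f f-inj = subst (2 ^ m ≤_) (+-comm 2 k)
  (injective⇒≤ (bitVector-injective ∘ f-inj ∘ refToFin-injective))

clear-prefix : ∀ {n} (S : Subset n) P L → toList S ≡ P ++ L →
  Σ (Subset n) λ V → toList V ≡ replicate (length P) false ++ L
clear-prefix S       []      L e = S , e
clear-prefix (b ∷ S) (c ∷ P) L e with clear-prefix S P L (Listₚ.∷-injectiveʳ e)
... | V , eV = false ∷ V , cong (false ∷_) eV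

module Residuals {n k} (Z : ZDD n k) (wf : WellFormed Z) {G : Family n} (rep : Represents Z G) where
  private
    ns = nodes Z

  label : Fin k → Fin n
  label x = lb (lookup ns x)

  levelOf : Ref k → ℕ
  levelOf ⊤ᵣ       = n
  levelOf ⊥ᵣ       = n
  levelOf (node x) = toℕ (label x)

  below-levelOf : ∀ l r → LabelAbove ns l r → toℕ l < levelOf r
  below-levelOf l ⊤ᵣ       _   = toℕ<n l
  below-levelOf l ⊥ᵣ       _   = toℕ<n l
  below-levelOf l (node x) l<x = l<x

  lo-above : ∀ x → toℕ (label x) < levelOf (lo (lookup ns x))
  lo-above x = below-levelOf _ _ (proj₁ (wf x))

  hi-above : ∀ x → toℕ (label x) < levelOf (hi (lookup ns x))
  hi-above x = below-levelOf _ _ (proj₂ (wf x))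

  avoids-below : ∀ {r S} → Mem ns r S → ∀ {y} → y < levelOf r → bitAt (toList S) y ≡ false
  avoids-below top                        _   = bitAt-∅ n _
  avoids-below (viaLo {i} m)              y<r = avoids-below m (<-trans y<r (lo-above i))
  avoids-below (viaHi {i} {S' = S′} m refl) y<r =
    trans (bitAt-⁅l⁆∪-≢ (label i) S′ (<⇒≢ y<r)) (avoids-below m (<-trans y<r (hi-above i)))

  -- r is the residual of the prefix P at level j: it represents the completions of P, shifted to start at j.
  Residual : ℕ → List Bool → Ref k → Set
  Residual j P r = ∀ {S V L} → toList S ≡ P ++ L → toList V ≡ replicate j false ++ L →
    (Mem ns r V → G S) × (G S → Mem ns r V)

  residual-root : Residual 0 [] (root Z)
  residual-root {S} {V} eS eV rewrite toList-inj {u = S} {V} (trans eS (sym eV)) = rep V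

  residual-false : ∀ {j P r} → Residual j P r → Residual (suc j) (P ++ false ∷ []) r
  residual-false {j} {P} res {L = L} eS eV =
    res (trans eS (Listₚ.++-assoc P _ L)) (trans eV (replicate-suc-++ j false L))

  residual-true : ∀ {j P r} (l : Fin n) → toℕ l ≡ j → Residual j P r →
    ∀ {S V L} → toList S ≡ (P ++ true ∷ []) ++ L → toList V ≡ replicate (suc j) false ++ L →
    (Mem ns r (⁅ l ⁆ ∪ V) → G S) × (G S → Mem ns r (⁅ l ⁆ ∪ V))
  residual-true {P = P} l refl res {V = V} {L} eS eV =
    res (trans eS (Listₚ.++-assoc P _ L)) (toList-⁅l⁆∪ l V L eV)

  skip-true : ∀ {j P r} → j < n → j < levelOf r → Residual j P r → Residual (suc j) (P ++ true ∷ []) ⊥ᵣ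
  skip-true {j} j<n j<r res {V = V} eS eV = (λ ()) , λ gS →
    contradiction (trans (sym (avoids-below (proj₂ (residual-true l (toℕ-fromℕ< j<n) res eS eV) gS) l<r))
                         (bitAt-⁅l⁆∪ l V)) λ ()
    where
    l = fromℕ< j<n
    l<r = subst (_< _) (sym (toℕ-fromℕ< j<n)) j<r

  follow-lo : ∀ {j P} x → toℕ (label x) ≡ j → Residual j P (node x) →
    Residual (suc j) (P ++ false ∷ []) (lo (lookup ns x))
  follow-lo x refl res {V = V} {L} eS eV = proj₁ viaNode ∘ viaLo , toLo ∘ proj₂ viaNode
    where
    viaNode = residual-false res eS eV
    l = toℕ (label x)
    toLo : Mem ns (node x) V → Mem ns (lo (lookup ns x)) V
    toLo (viaLo m) = m
    toLo (viaHi {S' = S′} m refl) = contradiction (begin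
      false                                  ≡⟨ bitAt-replicate-++-< (suc l) L (n<1+n l) ⟨
      bitAt (replicate (suc l) false ++ L) l ≡⟨ cong (λ B → bitAt B l) eV ⟨
      bitAt (toList (⁅ label x ⁆ ∪ S′)) l    ≡⟨ bitAt-⁅l⁆∪ (label x) S′ ⟩
      true                                   ∎) λ ()
      where open ≡-Reasoning

  follow-hi : ∀ {j P} x → toℕ (label x) ≡ j → Residual j P (node x) →
    Residual (suc j) (P ++ true ∷ []) (hi (lookup ns x))
  follow-hi x refl res {V = V} {L} eS eV = proj₁ viaNode ∘ (λ m → viaHi m refl) , toHi ∘ proj₂ viaNode
    where
    viaNode = residual-true (label x) refl res eS eV
    l = toℕ (label x)
    V-bit : bitAt (toList V) l ≡ false
    V-bit = trans (cong (λ B → bitAt B l) eV) (bitAt-replicate-++-< (suc l) L (n<1+n l))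
    toHi : Mem ns (node x) (⁅ label x ⁆ ∪ V) → Mem ns (hi (lookup ns x)) V
    toHi (viaLo m) = contradiction (trans (sym (avoids-below m (lo-above x))) (bitAt-⁅l⁆∪ (label x) V)) λ ()
    toHi (viaHi m e) =
      subst (Mem ns _) (sym (⁅l⁆∪-injective (label x) V-bit (avoids-below m (hi-above x)) e)) m

  Advanced : ℕ → List Bool → Set
  Advanced j P = Σ (Ref k) λ r → j ≤ levelOf r × Residual j P r

  skip : ∀ {j P} b r → j < n → j < levelOf r → Residual j P r → Advanced (suc j) (P ++ b ∷ [])
  skip false r j<n j<r res = r  , j<r , residual-false res
  skip true  r j<n j<r res = ⊥ᵣ , j<n , skip-true j<n j<r res

  follow : ∀ {j P} b x → toℕ (label x) ≡ j → Residual j P (node x) → Advanced (suc j) (P ++ b ∷ [])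
  follow false x l≡j res = lo (lookup ns x) , subst (_< _) l≡j (lo-above x) , follow-lo x l≡j res
  follow true  x l≡j res = hi (lookup ns x) , subst (_< _) l≡j (hi-above x) , follow-hi x l≡j res

  advance : ∀ {j P} b → j < n → Advanced j P → Advanced (suc j) (P ++ b ∷ [])
  advance {j} b j<n (node x , j≤r , res) with toℕ (label x) ≟ j
  ... | yes l≡j = follow b x l≡j res
  ... | no  l≢j = skip b (node x) j<n (≤∧≢⇒< j≤r (l≢j ∘ sym)) res
  advance b j<n (⊤ᵣ , _ , res) = skip b ⊤ᵣ j<n j<n res
  advance b j<n (⊥ᵣ , _ , res) = skip b ⊥ᵣ j<n j<n res

  walk : ∀ {j P} Q → j + length Q ≤ n → Advanced j P → Advanced (j + length Q) (P ++ Q)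
  walk {j} {P} []      _  a = subst₂ Advanced (sym (+-identityʳ j)) (sym (++-identityʳ P)) a
  walk {j} {P} (b ∷ Q) le a = subst₂ Advanced (sym (+-suc j (length Q))) (Listₚ.++-assoc P (b ∷ []) Q)
    (walk Q le′ (advance b (≤-trans (s≤s (m≤m+n j (length Q))) le′) a))
    where
    le′ : suc j + length Q ≤ n
    le′ = subst (_≤ n) (+-suc j (length Q)) le

  residual : ∀ P → length P ≤ n → Advanced (length P) P
  residual P le = walk P le (root Z , z≤n , residual-root)

  fooling-set-bound : ∀ {m j} (pre suf : Vec Bool m → List Bool) (set : Vec Bool m → Vec Bool m → Subset n) →
    j ≤ n → (∀ X → length (pre X) ≡ j) → (∀ X Y → toList (set X Y) ≡ pre X ++ suf Y) →
    (∀ X → G (set X X)) → (∀ X Y → G (set X Y) → G (set Y X) → X ≡ Y) → 2 ^ m ≤ k + 2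
  fooling-set-bound {m} {j} pre suf set j≤n len split diag fool = injection⇒2^m≤ residualOf injective
    where
    advanced : ∀ X → Advanced j (pre X)
    advanced X = subst (λ t → Advanced t (pre X)) (len X) (residual (pre X) (subst (_≤ n) (sym (len X)) j≤n))
    residualOf : Vec Bool m → Ref k
    residualOf X = proj₁ (advanced X)
    residualOf-spec : ∀ X → Residual j (pre X) (residualOf X)
    residualOf-spec X = proj₂ (proj₂ (advanced X))
    shifted : ∀ Y → Σ (Subset n) λ V → toList V ≡ replicate j false ++ suf Y
    shifted Y = subst (λ t → Σ (Subset n) λ V → toList V ≡ replicate t false ++ suf Y) (len Y)
                      (clear-prefix (set Y Y) (pre Y) (suf Y) (split Y Y))
    transfer : ∀ {X Y} Z → residualOf X ≡ residualOf Y → G (set X Z) → G (set Y Z)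
    transfer {X} {Y} Z e gXZ = proj₁ (residualOf-spec Y (split Y Z) (proj₂ (shifted Z)))
      (subst (λ r → Mem ns r (proj₁ (shifted Z))) e
        (proj₂ (residualOf-spec X (split X Z) (proj₂ (shifted Z))) gXZ))
    injective : ∀ {X Y} → residualOf X ≡ residualOf Y → X ≡ Y
    injective {X} {Y} e = fool X Y (transfer Y (sym e) (diag Y)) (transfer X e (diag X))

-- Subsets and extremal members

++-⊆⁺ : ∀ {m n} {p p′ : Subset m} {q q′ : Subset n} → p ⊆ p′ → q ⊆ q′ → p Vec.++ q ⊆ p′ Vec.++ q′
++-⊆⁺ {p = []}    {[]}     _   q⊆q′ = q⊆q′
++-⊆⁺ {p = _ ∷ _} {_ ∷ _} p⊆p′ q⊆q′ here with p⊆p′ here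
... | here = here
++-⊆⁺ {p = _ ∷ _} {_ ∷ _} p⊆p′ q⊆q′ (there x∈) = there (++-⊆⁺ (drop-∷-⊆ p⊆p′) q⊆q′ x∈)

++-⊆⁻ˡ : ∀ {m n} {p p′ : Subset m} {q q′ : Subset n} → p Vec.++ q ⊆ p′ Vec.++ q′ → p ⊆ p′
++-⊆⁻ˡ {p = _ ∷ _} {_ ∷ _} pq⊆ here with pq⊆ here
... | here = here
++-⊆⁻ˡ {p = _ ∷ _} {_ ∷ _} pq⊆ (there x∈) = there (++-⊆⁻ˡ (drop-∷-⊆ pq⊆) x∈)

++-⊆⁻ʳ : ∀ {m n} {p p′ : Subset m} {q q′ : Subset n} → p Vec.++ q ⊆ p′ Vec.++ q′ → q ⊆ q′
++-⊆⁻ʳ {p = []}    {[]}     pq⊆ = pq⊆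
++-⊆⁻ʳ {p = _ ∷ _} {_ ∷ _} pq⊆ = ++-⊆⁻ʳ (drop-∷-⊆ pq⊆)

⊆∧∣≤∣⇒≡ : ∀ {n} {p q : Subset n} → p ⊆ q → ∣ q ∣ ≤ ∣ p ∣ → p ≡ q
⊆∧∣≤∣⇒≡ {p = []}        {[]}        _    _  = refl
⊆∧∣≤∣⇒≡ {p = true ∷ p}  {true ∷ q}  p⊆q  le = cong (true ∷_) (⊆∧∣≤∣⇒≡ (drop-∷-⊆ p⊆q) (s≤s⁻¹ le))
⊆∧∣≤∣⇒≡ {p = true ∷ p}  {false ∷ q} p⊆q  _  = contradiction (p⊆q here) λ ()
⊆∧∣≤∣⇒≡ {p = false ∷ p} {true ∷ q}  p⊆q  le = contradiction le (<⇒≱ (s≤s (p⊆q⇒∣p∣≤∣q∣ (drop-∷-⊆ p⊆q))))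
⊆∧∣≤∣⇒≡ {p = false ∷ p} {false ∷ q} p⊆q  le = cong (false ∷_) (⊆∧∣≤∣⇒≡ (drop-∷-⊆ p⊆q) le)

⊆-pair-tight : ∀ {n} {p p′ q q′ : Subset n} → p ⊆ p′ → q ⊆ q′ →
  ∣ p′ ∣ + ∣ q′ ∣ ≤ ∣ p ∣ + ∣ q ∣ → p ≡ p′ × q ≡ q′
⊆-pair-tight {p = p} {p′} {q} {q′} p⊆ q⊆ le =
    ⊆∧∣≤∣⇒≡ p⊆ (+-cancelʳ-≤ (∣ q′ ∣) (∣ p′ ∣) (∣ p ∣) (≤-trans le (+-monoʳ-≤ (∣ p ∣) (p⊆q⇒∣p∣≤∣q∣ q⊆))))
  , ⊆∧∣≤∣⇒≡ q⊆ (+-cancelˡ-≤ (∣ p′ ∣) (∣ q′ ∣) (∣ q ∣) (≤-trans le (+-monoˡ-≤ (∣ q ∣) (p⊆q⇒∣p∣≤∣q∣ p⊆))))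

∣p∣+∣∁p∣≡n : ∀ {n} (p : Subset n) → ∣ p ∣ + ∣ ∁ p ∣ ≡ n
∣p∣+∣∁p∣≡n p = trans (cong (∣ p ∣ +_) (∣∁p∣≡n∸∣p∣ p)) (m+[n∸m]≡n (∣p∣≤n p))

Beyond : UnOp → ∀ {n} → Subset n → Subset n → Set
Beyond maxOp S S′ = S ⊆ S′
Beyond minOp S S′ = S′ ⊆ S

Extremal : UnOp → ∀ {n} → Family n → Family n
Extremal ◇ F S = F S × (∀ S′ → F S′ → Beyond ◇ S S′ → S ≡ S′)

apply⇔Extremal : ∀ ◇ {n} {F : Family n} {S} → (apply ◇ F S → Extremal ◇ F S) × (Extremal ◇ F S → apply ◇ F S)
apply⇔Extremal maxOp = id , id
apply⇔Extremal minOp = id , id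

beyond⇒comparable : ∀ ◇ {n} {S S′ : Subset n} → Beyond ◇ S S′ → S ⊆ S′ ⊎ S′ ⊆ S
beyond⇒comparable maxOp = inj₁
beyond⇒comparable minOp = inj₂

beyond-++ : ∀ ◇ {m n} {w w′ : Subset m} (v : Subset n) → Beyond ◇ w w′ → Beyond ◇ (w Vec.++ v) (w′ Vec.++ v)
beyond-++ maxOp v w⊆ = ++-⊆⁺ w⊆ (⊆-refl {x = v})
beyond-++ minOp v w⊆ = ++-⊆⁺ w⊆ (⊆-refl {x = v})

-- The family

ones : List Bool → ℕ
ones []          = 0
ones (true ∷ L)  = suc (ones L)
ones (false ∷ L) = ones L

ones-toList : ∀ {m} (a : Subset m) → ones (toList a) ≡ ∣ a ∣
ones-toList []          = refl
ones-toList (true ∷ a)  = cong suc (ones-toList a)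
ones-toList (false ∷ a) = ones-toList a

maybeToFin : ∀ {m} → Maybe (Fin m) → Fin (suc m)
maybeToFin nothing  = zero
maybeToFin (just i) = suc i

finToMaybe : ∀ {m} → Fin (suc m) → Maybe (Fin m)
finToMaybe zero    = nothing
finToMaybe (suc i) = just i

finToMaybe∘maybeToFin : ∀ {m} (d : Maybe (Fin m)) → finToMaybe (maybeToFin d) ≡ d
finToMaybe∘maybeToFin nothing  = refl
finToMaybe∘maybeToFin (just i) = refl

module Construction (m : ℕ) (p : Bool) where

  n : ℕ
  n = m + (m + m)

  data Phase : Set where
    scan  : Fin m → Phase
    count : ℕ → Phase

  phase : ℕ → Phase
  phase j with j <? m
  ... | yes j<m = scan (fromℕ< j<m)
  ... | no _ with j ∸ m <? m
  ...   | yes _ = count (j ∸ m)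
  ...   | no _  = count (j ∸ m ∸ m)

  phase-first : ∀ {j} (j<m : j < m) → phase j ≡ scan (fromℕ< j<m)
  phase-first {j} j<m with j <? m
  ... | yes _   = refl
  ... | no j≮m = contradiction j<m j≮m

  phase-second : ∀ {t} → t < m → phase (m + t) ≡ count t
  phase-second {t} t<m with m + t <? m
  ... | yes lt = contradiction lt (≤⇒≯ (m≤m+n m t))
  ... | no _ with m + t ∸ m <? m
  ...   | yes _  = cong count (m+n∸m≡n m t)
  ...   | no ge  = contradiction (subst (_< m) (sym (m+n∸m≡n m t)) t<m) ge

  m+m+t∸m≡m+t : ∀ t → m + m + t ∸ m ≡ m + t
  m+m+t∸m≡m+t t = trans (cong (_∸ m) (+-assoc m m t)) (m+n∸m≡n m (m + t))

  phase-third : ∀ t → phase (m + m + t) ≡ count t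
  phase-third t with m + m + t <? m
  ... | yes lt = contradiction lt (≤⇒≯ (≤-trans (m≤m+n m m) (m≤m+n (m + m) t)))
  ... | no _ with m + m + t ∸ m <? m
  ...   | yes lt = contradiction lt (≤⇒≯ (subst (m ≤_) (sym (m+m+t∸m≡m+t t)) (m≤m+n m t)))
  ...   | no _   = cong count (trans (cong (_∸ m) (m+m+t∸m≡m+t t)) (m+n∸m≡n m t))

  -- The deviation found in w, if any, and the number of ones still to be read in a and b.
  State : Set
  State = Maybe (Fin m) × Fin (suc m)

  scanStep : Fin m → State → Bool → Maybe State
  scanStep i q b with b ≟ᵇ p
  ... | yes _ = just q
  scanStep i (nothing , c) b | no _ = just (just i , c)
  scanStep i (just _ , c)  b | no _ = nothing

  readOne : State → Maybe State
  readOne (d , zero)  = nothing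
  readOne (d , suc c) = just (d , Fin.inject₁ c)

  readZero : ℕ → State → Maybe State
  readZero t (nothing , c) = just (nothing , c)
  readZero t (just i , c) with toℕ i ≟ t
  ... | yes _ = nothing
  ... | no _  = just (just i , c)

  countStep : ℕ → State → Bool → Maybe State
  countStep t q true  = readOne q
  countStep t q false = readZero t q

  stepAt : Phase → State → Bool → Maybe State
  stepAt (scan i)  = scanStep i
  stepAt (count t) = countStep t

  accepting : State → Bool
  accepting (_ , zero)  = true
  accepting (_ , suc _) = false

  encode : State → Fin (suc m * suc m)
  encode (d , c) = combine (maybeToFin d) c

  decode′ : Fin (suc m) × Fin (suc m) → State
  decode′ (e , c) = finToMaybe e , c

  initial : State
  initial = nothing , Fin.fromℕ m

  automaton : LayeredAutomaton n (suc m * suc m)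
  automaton = record
    { State         = State
    ; encode        = encode
    ; decode        = decode′ ∘ remQuot (suc m)
    ; decode∘encode = λ (d , c) → trans (cong decode′ (remQuot-combine {suc m} (maybeToFin d) c))
                                        (cong (_, c) (finToMaybe∘maybeToFin d))
    ; step          = stepAt ∘ phase
    ; accepting     = accepting
    ; initial       = initial
    }

  open LayeredAutomaton automaton public
    using (run; step; accepts; language; accepts⁻; accepts⁺; run-∷⁻; run-∷⁺; run-++⁻; run-++⁺)

  step-scan : ∀ {j} (j<m : j < m) q b → step j q b ≡ scanStep (fromℕ< j<m) q b
  step-scan j<m q b = cong (λ ph → stepAt ph q b) (phase-first j<m)

  first-block : ∀ {j r} → j + suc r ≤ m → j < m
  first-block {j} {r} le = ≤-trans (m≤m+n (suc j) r) (subst (_≤ m) (+-suc j r) le)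

  scanStep-sound : ∀ {i d c b d₁ c₁} → scanStep i (d , c) b ≡ just (d₁ , c₁) →
    c₁ ≡ c × (d₁ ≡ nothing → d ≡ nothing × b ≡ p)
  scanStep-sound {i} {d} {c} {b} e with b ≟ᵇ p
  scanStep-sound {d = d}       refl | yes b≡p = refl , λ d≡ → d≡ , b≡p
  scanStep-sound {d = nothing} refl | no _    = refl , λ ()

  scan-sound : ∀ {j} L {d c d′ c′} → j + length L ≤ m → run j (d , c) L ≡ just (d′ , c′) →
    c′ ≡ c × (d′ ≡ nothing → d ≡ nothing × L ≡ replicate (length L) p)
  scan-sound []      _  refl = refl , λ d≡ → d≡ , refl
  scan-sound {j} (b ∷ L) {d} {c} le e with run-∷⁻ L e
  ... | (d₁ , c₁) , s , e′
    with scanStep-sound {d = d} {c} {b} (trans (sym (step-scan (first-block le) _ b)) s)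
       | scan-sound L {d₁} {c₁} (subst (_≤ m) (+-suc j (length L)) le) e′
  ... | refl , step-ok | refl , rest-ok = refl , λ d′≡ →
    let (d₁≡ , L≡) = rest-ok d′≡ ; (d≡ , b≡) = step-ok d₁≡ in d≡ , cong₂ _∷_ b≡ L≡

  scan-padding : ∀ {j} r q → j + r ≤ m → run j q (replicate r p) ≡ just q
  scan-padding         zero    q _  = refl
  scan-padding {j} (suc r) q le =
    run-∷⁺ (replicate r p) (trans (step-scan (first-block le) q p) (scanStep-agree (fromℕ< (first-block le))))
           (scan-padding r q (subst (_≤ m) (+-suc j r) le))
    where
    scanStep-agree : ∀ i → scanStep i q p ≡ just q
    scanStep-agree i with p ≟ᵇ p
    ... | yes _  = refl
    ... | no p≢p = contradiction refl p≢p

  padding : Subset m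
  padding = Vec.replicate m p

  padded⇒≡padding : ∀ w → toList w ≡ replicate (length (toList w)) p → w ≡ padding
  padded⇒≡padding w e = toList-inj (begin
    toList w                         ≡⟨ e ⟩
    replicate (length (toList w)) p  ≡⟨ cong (λ r → replicate r p) (Vecₚ.length-toList w) ⟩
    replicate m p                    ≡⟨ toList-replicate m p ⟨
    toList padding                   ∎)
    where open ≡-Reasoning

  deviating : ∀ {r} → Fin r → Vec Bool r
  deviating {suc r} zero = not p ∷ Vec.replicate r p
  deviating (suc i)      = p ∷ deviating i

  toList-deviating : ∀ {r} (i : Fin r) →
    toList (deviating i) ≡ replicate (toℕ i) p ++ not p ∷ replicate (r ∸ suc (toℕ i)) p
  toList-deviating {suc r} zero = cong (not p ∷_) (toList-replicate r p)
  toList-deviating (suc i)      = cong (p ∷_) (toList-deviating i)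

  scan-deviating : ∀ (i : Fin m) c → run 0 (nothing , c) (toList (deviating i)) ≡ just (just i , c)
  scan-deviating i c = subst (λ L → run 0 (nothing , c) L ≡ just (just i , c)) (sym (toList-deviating i))
    (run-++⁺ 0 _ (replicate (toℕ i) p) after (scan-padding (toℕ i) _ (<⇒≤ (toℕ<n i)))
      (subst (λ j → run j (nothing , c) after ≡ just (just i , c)) (sym (Listₚ.length-replicate (toℕ i)))
        (run-∷⁺ (replicate (m ∸ suc (toℕ i)) p) (trans (step-scan (toℕ<n i) _ (not p)) deviate)
          (scan-padding (m ∸ suc (toℕ i)) _ (≤-reflexive (m+[n∸m]≡n (toℕ<n i)))))))
    where
    after = not p ∷ replicate (m ∸ suc (toℕ i)) p
    deviate : scanStep (fromℕ< (toℕ<n i)) (nothing , c) (not p) ≡ just (just i , c)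
    deviate with not p ≟ᵇ p
    ... | yes ¬p≡p = contradiction ¬p≡p (not-¬ refl ∘ sym)
    ... | no _     = cong (λ x → just (just x , c)) (fromℕ<-toℕ i (toℕ<n i))

  record Counting (j t : ℕ) (L : List Bool) : Set where
    constructor counting
    field phase-at : ∀ i → i < length L → phase (j + i) ≡ count (t + i)
  open Counting

  step-count : ∀ {j t b L} → Counting j t (b ∷ L) → ∀ q → step j q b ≡ countStep t q b
  step-count {j} {t} {b} h q =
    cong (λ ph → stepAt ph q b)
         (subst₂ (λ x y → phase x ≡ count y) (+-identityʳ j) (+-identityʳ t) (phase-at h 0 (s≤s z≤n)))

  counting-tail : ∀ {j t b L} → Counting j t (b ∷ L) → Counting (suc j) (suc t) L
  counting-tail {j} {t} h = counting λ i i<L →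
    subst₂ (λ x y → phase x ≡ count y) (+-suc j i) (+-suc t i) (phase-at h (suc i) (s≤s i<L))

  -- Marked t d L: if w deviated at position i, then L, read from offset t within its block, has a one at i.
  Marked : ℕ → Maybe (Fin m) → List Bool → Set
  Marked t d []      = ⊤
  Marked t d (b ∷ L) = (∀ {i} → d ≡ just i → toℕ i ≡ t → b ≡ true) × Marked (suc t) d L

  ones-∷ : ∀ b L x → ones (b ∷ []) + (ones L + x) ≡ ones (b ∷ L) + x
  ones-∷ true  L x = refl
  ones-∷ false L x = refl

  countStep-sound : ∀ {t d c b d₁ c₁} → countStep t (d , c) b ≡ just (d₁ , c₁) →
    d₁ ≡ d × toℕ c ≡ ones (b ∷ []) + toℕ c₁ × (∀ {i} → d ≡ just i → toℕ i ≡ t → b ≡ true)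
  countStep-sound {c = suc c} {true} refl = refl , cong suc (sym (toℕ-inject₁ c)) , λ _ _ → refl
  countStep-sound {d = nothing} {b = false} refl = refl , refl , λ ()
  countStep-sound {t} {just i} {c} {false} e with toℕ i ≟ t
  countStep-sound {t} {just i} {c} {false} refl | no i≢t = refl , refl , λ { refl i≡t → contradiction i≡t i≢t }

  countStep-complete : ∀ {t d c b L v} → (∀ {i} → d ≡ just i → toℕ i ≡ t → b ≡ true) →
    toℕ c ≡ ones (b ∷ L) + v → Σ (Fin (suc m)) λ c₁ → countStep t (d , c) b ≡ just (d , c₁) × toℕ c₁ ≡ ones L + v
  countStep-complete {c = suc c} {true} _ c≡ = Fin.inject₁ c , refl , trans (toℕ-inject₁ c) (suc-injective c≡)
  countStep-complete {d = nothing} {c} {false} _ c≡ = c , refl , c≡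
  countStep-complete {t} {just i} {c} {false} hit c≡ with toℕ i ≟ t
  ... | yes i≡t = contradiction (hit refl i≡t) λ ()
  ... | no _    = c , refl , c≡

  count-sound : ∀ L {j t d c d′ c′} → Counting j t L → run j (d , c) L ≡ just (d′ , c′) →
    d′ ≡ d × toℕ c ≡ ones L + toℕ c′ × Marked t d L
  count-sound []      h refl = refl , refl , tt
  count-sound (b ∷ L) {d = d} {c} h e with run-∷⁻ L e
  ... | (d₁ , c₁) , s , e′
    with countStep-sound {d = d} {c} {b} (trans (sym (step-count h _)) s)
       | count-sound L {d = d₁} {c₁} (counting-tail h) e′
  ... | refl , c≡ , hit | refl , c₁≡ , marked =
    refl , trans c≡ (trans (cong (ones (b ∷ []) +_) c₁≡) (ones-∷ b L _)) , hit , marked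

  count-complete : ∀ L {j t d c v} → Counting j t L → Marked t d L → toℕ c ≡ ones L + v →
    Σ (Fin (suc m)) λ c′ → run j (d , c) L ≡ just (d , c′) × toℕ c′ ≡ v
  count-complete []      {c = c} h _ c≡ = c , refl , c≡
  count-complete (b ∷ L) h (hit , marked) c≡ with countStep-complete {L = L} hit c≡
  ... | c₁ , s , c₁≡ with count-complete L (counting-tail h) marked c₁≡
  ...   | c′ , e , c′≡ = c′ , run-∷⁺ L (trans (step-count h _) s) e , c′≡

  marked-nothing : ∀ t L → Marked t nothing L
  marked-nothing t []      = tt
  marked-nothing t (b ∷ L) = (λ ()) , marked-nothing (suc t) L

  marked-past : ∀ {i t} L → toℕ i < t → Marked t (just i) L
  marked-past []      _   = tt
  marked-past (b ∷ L) i<t = (λ { refl i≡t → contradiction i≡t (<⇒≢ i<t) }) , marked-past L (m<n⇒m<1+n i<t)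

  marked⇒bitAt : ∀ {i t y} L → Marked t (just i) L → toℕ i ≡ t + y → y < length L → bitAt L y ≡ true
  marked⇒bitAt {t = t} {zero}  (b ∷ L) (hit , _) i≡ _ = hit refl (trans i≡ (+-identityʳ t))
  marked⇒bitAt {t = t} {suc y} (b ∷ L) (_ , marked) i≡ (s≤s y<L) =
    marked⇒bitAt L marked (trans i≡ (+-suc t y)) y<L

  bitAt⇒marked : ∀ {i t y} L → bitAt L y ≡ true → toℕ i ≡ t + y → Marked t (just i) L
  bitAt⇒marked {t = t} {zero} (b ∷ L) b≡ i≡ =
    (λ { refl _ → b≡ }) , marked-past L (subst (_< suc t) (sym (trans i≡ (+-identityʳ t))) (n<1+n t))
  bitAt⇒marked {t = t} {suc y} (b ∷ L) bit i≡ =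
    (λ { refl i≡t → contradiction (trans (trans (sym i≡t) i≡) (+-suc t y)) (m≢1+m+n t) })
    , bitAt⇒marked L bit (trans i≡ (+-suc t y))

  marked⇒∈ : ∀ {i} (a : Subset m) → Marked 0 (just i) (toList a) → i ∈ a
  marked⇒∈ {i} a marked = Vecₚ.lookup⇒[]= i a (trans (lookup≡bitAt a i)
    (marked⇒bitAt (toList a) marked refl (subst (toℕ i <_) (sym (Vecₚ.length-toList a)) (toℕ<n i))))

  ∈⇒marked : ∀ {i} (a : Subset m) → i ∈ a → Marked 0 (just i) (toList a)
  ∈⇒marked {i} a i∈a = bitAt⇒marked (toList a) (trans (sym (lookup≡bitAt a i)) (Vecₚ.[]=⇒lookup i∈a)) refl

  blocks : Subset m → Subset m → Subset m → Subset n
  blocks w a b = w Vec.++ (a Vec.++ b)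

  toList-blocks : ∀ w a b → toList (blocks w a b) ≡ toList w ++ (toList a ++ toList b)
  toList-blocks w a b = trans (Vecₚ.toList-++ w _) (cong (toList w ++_) (Vecₚ.toList-++ a b))

  counting-second : ∀ (w a : Subset m) → Counting (0 + length (toList w)) 0 (toList a)
  counting-second w a = counting λ i i<a → subst (λ j → phase (j + i) ≡ count i) (sym (Vecₚ.length-toList w))
    (phase-second (subst (i <_) (Vecₚ.length-toList a) i<a))

  counting-third : ∀ (w a b : Subset m) → Counting (0 + length (toList w) + length (toList a)) 0 (toList b)
  counting-third w a b = counting λ i _ →
    subst (λ j → phase (j + i) ≡ count i) (sym (cong₂ _+_ (Vecₚ.length-toList w) (Vecₚ.length-toList a)))
          (phase-third i)

  language⇒ : ∀ w a b → language (blocks w a b) →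
    ∣ a ∣ + ∣ b ∣ ≡ m × (w ≡ padding ⊎ Σ (Fin m) λ i → i ∈ a × i ∈ b)
  language⇒ w a b acc with accepts⁻ 0 initial (toList (blocks w a b)) acc
  ... | (d₃ , zero) , e , _
    with run-++⁻ 0 initial (toList w) (toList a ++ toList b)
                 (subst (λ L → run 0 initial L ≡ _) (toList-blocks w a b) e)
  ... | (d₁ , c₁) , e-w , e-ab with run-++⁻ _ (d₁ , c₁) (toList a) (toList b) e-ab
  ... | (d₂ , c₂) , e-a , e-b
    with scan-sound (toList w) (≤-reflexive (Vecₚ.length-toList w)) e-w
       | count-sound (toList a) (counting-second w a) e-a
       | count-sound (toList b) (counting-third w a b) e-b
  ... | refl , padded | refl , c₁≡ , marked-a | refl , c₂≡ , marked-b =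
    total , witness d₁ (padded⇒≡padding w ∘ proj₂ ∘ padded) marked-a marked-b
    where
    total : ∣ a ∣ + ∣ b ∣ ≡ m
    total = begin
      ∣ a ∣ + ∣ b ∣                        ≡⟨ cong₂ _+_ (ones-toList a) (ones-toList b) ⟨
      ones (toList a) + ones (toList b)     ≡⟨ cong (ones (toList a) +_) (trans (sym (+-identityʳ _)) (sym c₂≡)) ⟩
      ones (toList a) + toℕ c₂              ≡⟨ c₁≡ ⟨
      toℕ (Fin.fromℕ m)                     ≡⟨ toℕ-fromℕ m ⟩
      m                                     ∎
      where open ≡-Reasoning
    witness : ∀ d → (d ≡ nothing → w ≡ padding) →
      Marked 0 d (toList a) → Marked 0 d (toList b) → w ≡ padding ⊎ Σ (Fin m) λ i → i ∈ a × i ∈ b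
    witness nothing  padded _  _  = inj₁ (padded refl)
    witness (just i) _      ma mb = inj₂ (i , marked⇒∈ a ma , marked⇒∈ b mb)

  language⇐ : ∀ w a b d → run 0 initial (toList w) ≡ just (d , Fin.fromℕ m) →
    Marked 0 d (toList a) → Marked 0 d (toList b) → ∣ a ∣ + ∣ b ∣ ≡ m → language (blocks w a b)
  language⇐ w a b d e-w marked-a marked-b total
    with count-complete (toList a) (counting-second w a) marked-a
           (trans (toℕ-fromℕ m) (trans (sym total) (cong₂ _+_ (sym (ones-toList a)) (sym (ones-toList b)))))
  ... | c₂ , e-a , c₂≡
    with count-complete (toList b) (counting-third w a b) marked-b (trans c₂≡ (sym (+-identityʳ _)))
  ... | zero , e-b , _ = subst (λ L → accepts 0 initial L ≡ true) (sym (toList-blocks w a b))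
    (accepts⁺ 0 initial (toList w ++ (toList a ++ toList b))
      (run-++⁺ 0 initial (toList w) _ e-w (run-++⁺ _ _ (toList a) (toList b) e-a e-b)) refl)

  padding-accepted : ∀ a b → ∣ a ∣ + ∣ b ∣ ≡ m → language (blocks padding a b)
  padding-accepted a b =
    language⇐ padding a b nothing
      (trans (cong (run 0 initial) (toList-replicate m p)) (scan-padding m initial ≤-refl))
      (marked-nothing 0 (toList a)) (marked-nothing 0 (toList b))

  deviating-accepted : ∀ a b {i} → ∣ a ∣ + ∣ b ∣ ≡ m → i ∈ a → i ∈ b → language (blocks (deviating i) a b)
  deviating-accepted a b {i} total i∈a i∈b =
    language⇐ (deviating i) a b (just i) (scan-deviating i (Fin.fromℕ m))
      (∈⇒marked a i∈a) (∈⇒marked b i∈b) total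

  lookup-deviating : ∀ {r} (i : Fin r) → lookup (deviating i) i ≡ not p
  lookup-deviating {suc r} zero = refl
  lookup-deviating (suc i)      = lookup-deviating i

  padding≢deviating : ∀ {a b} i → blocks padding a b ≢ blocks (deviating i) a b
  padding≢deviating i e = not-¬ refl (begin
    p                      ≡⟨ Vecₚ.lookup-replicate i p ⟨
    lookup padding i       ≡⟨ cong (λ w → lookup w i) (Vecₚ.++-injectiveˡ padding (deviating i) e) ⟩
    lookup (deviating i) i ≡⟨ lookup-deviating i ⟩
    not p                  ∎)
    where open ≡-Reasoning

  blocks-split : ∀ S → Σ (Subset m) λ w → Σ (Subset m) λ a → Σ (Subset m) λ b → S ≡ blocks w a b
  blocks-split S with Vec.splitAt m S
  ... | w , ab , refl with Vec.splitAt m ab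
  ... | a , b , refl = w , a , b , refl

  blocks-⊆⁻ : ∀ w a b w′ a′ b′ → blocks w a b ⊆ blocks w′ a′ b′ → a ⊆ a′ × b ⊆ b′
  blocks-⊆⁻ w a b w′ a′ b′ h = ++-⊆⁻ˡ {p = a} {a′} {b} {b′} ab⊆ , ++-⊆⁻ʳ {p = a} {a′} ab⊆
    where
    ab⊆ = ++-⊆⁻ʳ {p = w} {w′} h

  cross : Subset m → Subset m → Subset n
  cross X Y = blocks padding X (∁ Y)

  diagonal-accepted : ∀ A → language (cross A A)
  diagonal-accepted A = padding-accepted A (∁ A) (∣p∣+∣∁p∣≡n A)

  comparable-diagonal⇒middle : ∀ A {w a b} → ∣ a ∣ + ∣ b ∣ ≡ m →
    cross A A ⊆ blocks w a b ⊎ blocks w a b ⊆ cross A A → A ≡ a × ∁ A ≡ b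
  comparable-diagonal⇒middle A {w} {a} {b} total (inj₁ A⊆S) =
    uncurry ⊆-pair-tight (blocks-⊆⁻ padding A (∁ A) w a b A⊆S)
                         (≤-reflexive (trans total (sym (∣p∣+∣∁p∣≡n A))))
  comparable-diagonal⇒middle A {w} {a} {b} total (inj₂ S⊆A)
    with uncurry ⊆-pair-tight (blocks-⊆⁻ w a b padding A (∁ A) S⊆A)
                              (≤-reflexive (trans (∣p∣+∣∁p∣≡n A) (sym total)))
  ... | refl , refl = refl , refl

  comparable-diagonal⇒≡ : ∀ A {S} → language S → cross A A ⊆ S ⊎ S ⊆ cross A A → cross A A ≡ S
  comparable-diagonal⇒≡ A {S} accS comparable with blocks-split S
  ... | w , a , b , refl with language⇒ w a b accS
  ... | total , witness with comparable-diagonal⇒middle A {w} {a} {b} total comparable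
  ... | refl , refl with witness
  ...   | inj₁ refl = refl
  ...   | inj₂ (i , i∈A , i∈∁A) = contradiction i∈∁A (x∈p⇒x∉∁p i∈A)

  off-diagonal-accepted : ∀ {X Y i} → language (cross X Y) → i ∉ Y → i ∈ X →
    language (blocks (deviating i) X (∁ Y))
  off-diagonal-accepted {X} {Y} acc i∉Y i∈X =
    deviating-accepted X (∁ Y) (proj₁ (language⇒ padding X (∁ Y) acc)) i∈X (x∉p⇒x∈∁p i∉Y)

padBit : UnOp → Bool
padBit maxOp = false
padBit minOp = true

padding-beyond : ∀ ◇ {m} (i : Fin m) →
  Beyond ◇ (Construction.padding m (padBit ◇)) (Construction.deviating m (padBit ◇) i)
padding-beyond maxOp i = ⊥⊆
padding-beyond minOp i = ⊆⊤

module Extremes (◇ : UnOp) (m : ℕ) where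
  open Construction m (padBit ◇)

  diagonal-extremal : ∀ A → apply ◇ language (cross A A)
  diagonal-extremal A = proj₂ (apply⇔Extremal ◇)
    (diagonal-accepted A , λ S accS beyond → comparable-diagonal⇒≡ A accS (beyond⇒comparable ◇ beyond))

  off-diagonal-not-extremal : ∀ {X Y i} → i ∉ Y → i ∈ X → ¬ apply ◇ language (cross X Y)
  off-diagonal-not-extremal {X} {Y} {i} i∉Y i∈X ext with proj₁ (apply⇔Extremal ◇) ext
  ... | acc , extremal = padding≢deviating {X} {∁ Y} i
    (extremal _ (off-diagonal-accepted acc i∉Y i∈X) (beyond-++ ◇ (X Vec.++ ∁ Y) (padding-beyond ◇ i)))

  cross-extremal⇒⊆ : ∀ {X Y} → apply ◇ language (cross X Y) → X ⊆ Y
  cross-extremal⇒⊆ {X} {Y} ext {i} i∈X with i ∈? Y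
  ... | yes i∈Y = i∈Y
  ... | no  i∉Y = contradiction ext (off-diagonal-not-extremal i∉Y i∈X)

  extremal-size : ∀ k (Z : ZDD n k) → WellFormed Z → Represents Z (apply ◇ language) → 2 ^ m ≤ k + 2
  extremal-size k Z wf rep = fooling-set-bound
    (λ X → toList padding ++ toList X) (toList ∘ ∁) cross
    (+-monoʳ-≤ m (m≤m+n m m)) length-prefix toList-cross diagonal-extremal
    (λ X Y eXY eYX → ⊆-antisym (cross-extremal⇒⊆ eXY) (cross-extremal⇒⊆ eYX))
    where
    open Residuals Z wf rep
    length-prefix : ∀ X → length (toList padding ++ toList X) ≡ m + m
    length-prefix X = trans (Listₚ.length-++ (toList padding))
                            (cong₂ _+_ (Vecₚ.length-toList padding) (Vecₚ.length-toList X))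
    toList-cross : ∀ X Y → toList (cross X Y) ≡ (toList padding ++ toList X) ++ toList (∁ Y)
    toList-cross X Y = trans (toList-blocks padding X (∁ Y)) (sym (Listₚ.++-assoc (toList padding) (toList X) _))

Z≤-weaken : ∀ {n} {F : Family n} {b b′} → b ≤ b′ → Z≤ F b → Z≤ F b′
Z≤-weaken b≤b′ (k , Z , wf , rep , size≤b) = k , Z , wf , rep , ≤-trans size≤b b≤b′

ground-size : ∀ x → let m = suc x in m + (m + m) ≤ 3 * m ^ 2
ground-size x = subst (suc x + (suc x + suc x) ≤_) (identity x) (m≤m+n _ _)
  where
  identity : ∀ x → suc x + (suc x + suc x) + (3 * x ^ 2 + 3 * x) ≡ 3 * suc x ^ 2
  identity = solve 1 (λ x → ((con 1 :+ x) :+ ((con 1 :+ x) :+ (con 1 :+ x))) :+ (con 3 :* x :^ 2 :+ con 3 :* x)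
                            := con 3 :* (con 1 :+ x) :^ 2) refl

zdd-size : ∀ x → let m = suc x in (m + (m + m)) * (suc m * suc m) + 2 ≤ 14 * m ^ 4
zdd-size x = subst ((suc x + (suc x + suc x)) * (suc (suc x) * suc (suc x)) + 2 ≤_) (identity x) (m≤m+n _ _)
  where
  identity : ∀ x → (suc x + (suc x + suc x)) * (suc (suc x) * suc (suc x)) + 2
                   + (14 * x ^ 4 + 53 * x ^ 3 + 69 * x ^ 2 + 32 * x) ≡ 14 * suc x ^ 4
  identity = solve 1 (λ x → ((con 1 :+ x) :+ ((con 1 :+ x) :+ (con 1 :+ x)))
                                :* ((con 2 :+ x) :* (con 2 :+ x)) :+ con 2
                            :+ (con 14 :* x :^ 4 :+ con 53 :* x :^ 3 :+ con 69 :* x :^ 2 :+ con 32 :* x)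
                            := con 14 :* (con 1 :+ x) :^ 4) refl

theorem11 : (◇ : UnOp) →
    Σ (ℕ → Σ ℕ Family) λ G →
    Σ ℕ λ C → Σ ℕ λ D → Σ ℕ λ c → Σ ℕ λ d → Σ ℕ λ m₀ →
      ∀ m → 1 ≤ m → m₀ ≤ m →
        (proj₁ (G m) ≤ C * (m ^ 2)) ×
        Z≤ (proj₂ (G m)) (D * (m ^ 4)) ×
        Z≥frac (apply ◇ (proj₂ (G m))) (2 ^ m) (c * (m ^ d))
theorem11 ◇ = (λ m → n m (padBit ◇) , language m (padBit ◇)) , 3 , 14 , 1 , 0 , 1 , bounds
  where
  open Construction using (n; language; automaton)
  bounds : ∀ m → 1 ≤ m → 1 ≤ m →
    (n m (padBit ◇) ≤ 3 * m ^ 2) × Z≤ (language m (padBit ◇)) (14 * m ^ 4) ×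
    Z≥frac (apply ◇ (language m (padBit ◇))) (2 ^ m) (1 * m ^ 0)
  bounds (suc x) _ _ =
      ground-size x
    , Z≤-weaken (zdd-size x) (LayeredZDD.language-Z≤ (automaton (suc x) (padBit ◇)))
    , λ k Z wf rep → subst (2 ^ suc x ≤_) (sym (*-identityʳ (k + 2)))
                           (Extremes.extremal-size ◇ (suc x) k Z wf rep)
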